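{- Let $F$ be a field of characteristic different from $2$ and let $n\in\mathbb N$. Then $$\sup_{\varphi\in I^nF}\mathrm{sl}_n(\varphi)\leq |P_nF|.$$
   Context: All quadratic forms are finite-dimensional and nondegenerate, and a form is identified with its Witt class in the Witt ring $W(F)$. $IF$ is the fundamental ideal of $W(F)$ and $I^nF$ its $n$-th power. For $a_1,\dots,a_n\in F^*$ put $\langle\langle a_1,\dots,a_n\rangle\rangle:=\langle 1,a_1\rangle\otimes\cdots\otimes\langle 1,a_n\rangle$ (an $n$-fold Pfister form). $P_nF$ is the set of isometry classes of $n$-fold Pfister forms over $F$, and $GP_nF$ is the set of forms similar to an $n$-fold Pfister form. For $\varphi\in I^nF$, $\mathrm{sl}_n(\varphi):=\min\{k\in\mathbb N_0\mid \exists \pi_1,\dots,\pi_k\in GP_nF:\ \varphi\equiv\pi_1+\dots+\pi_k \bmod I^{n+1}F\}$. The cardinality $|P_nF|$ may be infinite. -}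

module Defs where

open import Level using (Level; _⊔_)
open import Algebra.Bundles using (CommutativeRing)
open import Data.Nat using (ℕ; zero; suc; _≤_)
open import Data.Fin using (Fin; zero; suc; _≟_)
open import Data.List using (List; []; _∷_; _++_; length; map; concatMap; lookup; replicate; concat; foldr)
open import Data.List.Relation.Unary.All using (All)
open import Data.Vec using (Vec)
import Data.Vec as V
open import Data.Product using (Σ; _×_; ∃; ∃-syntax; _,_)
open import Relation.Nullary using (¬_; yes; no)
open import Relation.Binary.PropositionalEquality using (_≡_)

record Field (c ℓ : Level) : Set (Level.suc (c ⊔ ℓ)) where
  field
    commRing : CommutativeRing c ℓ
  open CommutativeRing commRing public
  field
    0≉1     : ¬ (0# ≈ 1#)
    inverse : ∀ x → ¬ (x ≈ 0#) → ∃[ y ] (x * y ≈ 1#)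

module QuadraticForms {c ℓ : Level} (F : Field c ℓ) where
  open Field F using (Carrier; _≈_; _+_; _*_; -_; 0#; 1#)

  CharNot2 : Set ℓ
  CharNot2 = ¬ ((1# + 1#) ≈ 0#)

  sumF : ∀ {m} → (Fin m → Carrier) → Carrier
  sumF {zero}  f = 0#
  sumF {suc m} f = f zero + sumF (λ i → f (suc i))

  δ : ∀ {m} → Fin m → Fin m → Carrier
  δ i j with i ≟ j
  ... | yes _ = 1#
  ... | no  _ = 0#

  -- A quadratic form in diagonal shape ⟨a₁,…,aₘ⟩ (every nondegenerate form
  -- over a field of characteristic ≠ 2 is diagonalizable).
  Form : Set c
  Form = List Carrier

  dim : Form → ℕ
  dim = length

  coeff : (φ : Form) → Fin (dim φ) → Carrier
  coeff = lookup

  Nondeg : Form → Set (c ⊔ ℓ)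
  Nondeg φ = All (λ a → ¬ (a ≈ 0#)) φ

  ⟨_⟩ : Carrier → Form
  ⟨ a ⟩ = a ∷ []

  _⊥_ : Form → Form → Form
  _⊥_ = _++_

  neg : Form → Form
  neg = map (-_)

  _⊗_ : Form → Form → Form
  φ ⊗ ψ = concatMap (λ a → map (a *_) ψ) φ

  _≅_ : Form → Form → Set (c ⊔ ℓ)
  φ ≅ ψ = Σ (Fin (dim φ) → Fin (dim ψ) → Carrier) λ M →
          Σ (Fin (dim ψ) → Fin (dim φ) → Carrier) λ N →
      ((∀ j j' → sumF (λ i → coeff φ i * (M i j * M i j')) ≈ δ j j' * coeff ψ j)
     × (∀ i i' → sumF (λ j → M i j * N j i') ≈ δ i i')
     × (∀ j j' → sumF (λ i → N j i * M i j') ≈ δ j j'))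

  ℍ : Form
  ℍ = 1# ∷ (- 1#) ∷ []

  Hyperbolic : Form → Set (c ⊔ ℓ)
  Hyperbolic φ = ∃[ m ] (φ ≅ concat (replicate m ℍ))

  -- Witt equivalence: φ and ψ have the same class in W(F)
  _∼_ : Form → Form → Set (c ⊔ ℓ)
  φ ∼ ψ = Hyperbolic (φ ⊥ neg ψ)

  ⊥-sum : List Form → Form
  ⊥-sum = foldr _⊥_ []

  ⊗-prod : ∀ {n} → Vec Form n → Form
  ⊗-prod = V.foldr _ _⊗_ ⟨ 1# ⟩

  -- IF: classes of even-dimensional forms
  Even : ℕ → Set
  Even m = ∃[ k ] (m ≡ k Data.Nat.+ k)

  InI : Form → Set
  InI φ = Even (dim φ)

  -- I^n F = n-th power of the ideal IF: the (classes of) finite sums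
  -- Σ r ⊗ x₁ ⊗ ⋯ ⊗ xₙ with r ∈ W(F), xᵢ ∈ IF (all forms nondegenerate).
  Term : ℕ → Set c
  Term n = Form × Vec Form n

  termForm : ∀ {n} → Term n → Form
  termForm (r , xs) = r ⊗ ⊗-prod xs

  ValidTerm : ∀ {n} → Term n → Set (c ⊔ ℓ)
  ValidTerm (r , xs) = Nondeg r × V.foldr _ (λ x P → (Nondeg x × InI x) × P) (Level.Lift (c ⊔ ℓ) Data.Unit.⊤) xs
    where import Data.Unit

  InIPow : ℕ → Form → Set (c ⊔ ℓ)
  InIPow n φ = Σ (List (Term n)) λ ts → (All ValidTerm ts × (φ ∼ ⊥-sum (map termForm ts)))

  Units : ℕ → Set (c ⊔ ℓ)
  Units n = Vec (Σ Carrier (λ a → ¬ (a ≈ 0#))) n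

  pfister : ∀ {n} → Units n → Form
  pfister as = ⊗-prod (V.map (λ a → 1# ∷ Data.Product.proj₁ a ∷ []) as)

  InGP : ℕ → Form → Set (c ⊔ ℓ)
  InGP n π = Σ Carrier λ a → (¬ (a ≈ 0#)) × Σ (Units n) λ as → (π ≅ (⟨ a ⟩ ⊗ pfister as))

  -- |P_n F| = k: a list of k pairwise non-isometric n-fold Pfister forms
  -- such that every n-fold Pfister form is isometric to one of them.
  PfisterCard : ℕ → ℕ → Set (c ⊔ ℓ)
  PfisterCard n k = Σ (Vec (Units n) k) λ ps →
      ((∀ (i j : Fin k) → pfister (V.lookup ps i) ≅ pfister (V.lookup ps j) → i ≡ j)
     × (∀ (as : Units n) → ∃[ i ] (pfister as ≅ pfister (V.lookup ps i))))

  -- sl_n(φ) ≤ k: φ ≡ π₁ + ⋯ + πₘ mod I^{n+1}F with πᵢ ∈ GP_n F, m ≤ k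
  SlnAtMost : ℕ → Form → ℕ → Set (c ⊔ ℓ)
  SlnAtMost n φ k = Σ (List Form) λ πs →
      (length πs ≤ k × All (InGP n) πs × InIPow (suc n) (φ ⊥ neg (⊥-sum πs)))

module Submission where

-- By multilinearity and ⟨c, d⟩ ≅ c⟨⟨cd⟩⟩, every element r ⊗ x₁ ⊗ ⋯ ⊗ xₙ of IⁿF with
-- even-dimensional xᵢ is isometric to a sum of scaled Pfister forms a⟨⟨a₁,…,aₙ⟩⟩.
-- Sort these summands by the isometry class of their Pfister part. Within one class,
-- a⟨⟨as⟩⟩ ⊥ b⟨⟨as⟩⟩ ≅ ⟨a, b⟩⟨⟨as⟩⟩ ≅ a⟨⟨ab, as⟩⟩ lies in Iⁿ⁺¹F, so pairing off the
-- summands of each class leaves at most one of them modulo Iⁿ⁺¹F, i.e. at most |PₙF| in all.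

open import Defs
open import Level using (Level; _⊔_; Lift; lift)
open import Data.Unit using (⊤; tt)
open import Data.Empty using (⊥-elim)
open import Function using (_∘_)
open import Data.Nat using (ℕ; zero; suc)
import Data.Nat as ℕ
import Data.Nat.Properties as ℕₚ
open import Data.Fin using (Fin; zero; suc; _≟_; cast)
import Data.Fin.Properties as Finₚ
open import Data.Fin.Permutation.Components using (transpose; transpose-inverse)
open import Data.Product using (Σ; _×_; _,_; proj₁; proj₂; ∃-syntax)
import Data.Product as Product
open import Data.List using (List; []; _∷_; _++_; map; length; concatMap; concat; replicate)
import Data.List.Properties as Listₚ
open import Data.List.Relation.Unary.All using (All; []; _∷_)
import Data.List.Relation.Unary.All.Properties as Allₚ
open import Data.List.Relation.Binary.Pointwise using (Pointwise; []; _∷_)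
import Data.List.Relation.Binary.Pointwise as Pointwiseₚ
open import Data.List.Relation.Binary.Permutation.Propositional as ↭ using (_↭_)
import Data.List.Relation.Binary.Permutation.Propositional.Properties as ↭ₚ
open import Data.Vec using (Vec) renaming ([] to []ᵛ; _∷_ to _∷ᵛ_)
import Data.Vec as Vec
open import Relation.Nullary using (¬_; yes; no)
open import Relation.Binary.Bundles using (Setoid)
import Relation.Binary.Reasoning.Setoid as SetoidReasoning
import Relation.Binary.PropositionalEquality as ≡
open ≡ using (_≡_)
import Algebra.Properties.Ring as RingProperties

module Matrices {c ℓ : Level} (F : Field c ℓ) where
  open Field F hiding (zero)
  open QuadraticForms F
  open import Algebra.Properties.Semiring.Sum semiring
    using (sum; sum-cong-≋; sum-replicate-zero; ∑-comm; *-distribˡ-sum)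
  open import Algebra.Solver.CommutativeMonoid *-commutativeMonoid using (solve; _⊜_; _⊕_)
  open SetoidReasoning setoid

  private variable
    m p q : ℕ

  sumF≡sum : (f : Fin m → Carrier) → sumF f ≡ sum f
  sumF≡sum {zero}  f = ≡.refl
  sumF≡sum {suc m} f = ≡.cong (f zero +_) (sumF≡sum (f ∘ suc))

  sum-zero : {f : Fin m → Carrier} → (∀ i → f i ≈ 0#) → sum f ≈ 0#
  sum-zero {m} f≈0 = trans (sum-cong-≋ f≈0) (sum-replicate-zero m)

  sum-*ʳ : ∀ (f : Fin m → Carrier) a → sum (λ i → f i * a) ≈ sum f * a
  sum-*ʳ f a = trans (sum-cong-≋ λ i → *-comm (f i) a)
                     (trans (sym (*-distribˡ-sum a f)) (*-comm a (sum f)))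

  δ-cong : {i j : Fin m} {k l : Fin p} → (i ≡ j → k ≡ l) → (k ≡ l → i ≡ j) → δ i j ≈ δ k l
  δ-cong {i = i} {j} {k} {l} to from with i ≟ j | k ≟ l
  ... | yes _   | yes _   = refl
  ... | no  _   | no  _   = refl
  ... | yes i≡j | no  k≢l = ⊥-elim (k≢l (to i≡j))
  ... | no  i≢j | yes k≡l = ⊥-elim (i≢j (from k≡l))

  δ-sym : (i j : Fin m) → δ i j ≈ δ j i
  δ-sym i j = δ-cong {i = i} {j} ≡.sym ≡.sym

  δ-suc : (i j : Fin m) → δ (suc i) (suc j) ≈ δ i j
  δ-suc i j = δ-cong {i = suc i} {suc j} Finₚ.suc-injective (≡.cong suc)

  sum-δ : (j : Fin m) (f : Fin m → Carrier) → sum (λ i → δ j i * f i) ≈ f j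
  sum-δ zero f = begin
    1# * f zero + sum (λ i → 0# * f (suc i))
      ≈⟨ +-cong (*-identityˡ _) (sum-zero {f = λ i → 0# * f (suc i)} λ i → zeroˡ _) ⟩
    f zero + 0#                        ≈⟨ +-identityʳ _ ⟩
    f zero                             ∎
  sum-δ (suc j) f = begin
    0# * f zero + sum (λ i → δ (suc j) (suc i) * f (suc i))
      ≈⟨ +-cong (zeroˡ _) (sum-cong-≋ λ i → *-congʳ {f (suc i)} (δ-suc j i)) ⟩
    0# + sum (λ i → δ j i * f (suc i)) ≈⟨ +-identityˡ _ ⟩
    sum (λ i → δ j i * f (suc i))      ≈⟨ sum-δ j (f ∘ suc) ⟩
    f (suc j)                          ∎

  sum-* : (f : Fin m → Carrier) (g : Fin p → Carrier) →
          sum f * sum g ≈ sum (λ j → sum (λ j' → f j * g j'))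
  sum-* f g = begin
    sum f * sum g                         ≈⟨ sum-*ʳ f (sum g) ⟨
    sum (λ j → f j * sum g)               ≈⟨ sum-cong-≋ (λ j → *-distribˡ-sum (f j) g) ⟩
    sum (λ j → sum (λ j' → f j * g j'))   ∎

  Matrix : ℕ → ℕ → Set c
  Matrix m p = Fin m → Fin p → Carrier

  infixl 7 _·_
  _·_ : Matrix m p → Matrix p q → Matrix m q
  (A · B) i k = sum λ j → A i j * B j k

  Inverse : Matrix m p → Matrix p m → Set ℓ
  Inverse A B = ∀ i i' → (A · B) i i' ≈ δ i i'

  gram : (Fin m → Carrier) → Matrix m p → Matrix p p
  gram d M j j' = sum λ i → d i * (M i j * M i j')

  Diagonalises : (Fin m → Carrier) → Matrix m p → (Fin p → Carrier) → Set ℓ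
  Diagonalises d M e = ∀ j j' → gram d M j j' ≈ δ j j' * e j

  -- φ ≅ ψ is Iso (coeff φ) (coeff ψ), up to sumF ≡ sum
  record Iso (d : Fin m → Carrier) (e : Fin p → Carrier) : Set (c ⊔ ℓ) where
    field
      P   : Matrix m p
      P⁻¹ : Matrix p m
      diagonalises : Diagonalises d P e
      P·P⁻¹        : Inverse P P⁻¹
      P⁻¹·P        : Inverse P⁻¹ P
  open Iso

  gram-cong : (d : Fin m → Carrier) {A B : Matrix m p} → (∀ i j → A i j ≈ B i j) →
              ∀ j j' → gram d A j j' ≈ gram d B j j'
  gram-cong d A≈B j j' = sum-cong-≋ λ i → *-congˡ (*-cong (A≈B i j) (A≈B i j'))

  diagonalises-δ : (d : Fin m → Carrier) → Diagonalises d δ d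
  diagonalises-δ d j j' = begin
    sum (λ i → d i * (δ i j * δ i j'))  ≈⟨ sum-cong-≋ (λ i → *-congˡ (*-congʳ (δ-sym i j))) ⟩
    sum (λ i → d i * (δ j i * δ i j'))  ≈⟨ sum-cong-≋ (λ i →
      solve 3 (λ x y z → x ⊕ (y ⊕ z) ⊜ y ⊕ (z ⊕ x)) refl (d i) (δ j i) (δ i j')) ⟩
    sum (λ i → δ j i * (δ i j' * d i))  ≈⟨ sum-δ j (λ i → δ i j' * d i) ⟩
    δ j j' * d j                        ∎

  inverse-δ : Inverse {m} δ δ
  inverse-δ i i' = sum-δ i (λ j → δ j i')

  gram-· : (d : Fin m → Carrier) (A : Matrix m p) (B : Matrix p q) → ∀ l l' →
           gram d (A · B) l l' ≈ sum (λ j → sum (λ j' → (B j l * B j' l') * gram d A j j'))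
  gram-· {m} {p} d A B l l' = begin
    sum (λ i → d i * ((A · B) i l * (A · B) i l'))
      ≈⟨ sum-cong-≋ (λ i → *-congˡ (sum-* (λ j → A i j * B j l) (λ j' → A i j' * B j' l'))) ⟩
    sum (λ i → d i * sum (λ j → sum (λ j' → (A i j * B j l) * (A i j' * B j' l'))))
      ≈⟨ sum-cong-≋ (λ i → trans (*-distribˡ-sum (d i) (λ j → sum (λ j' → f i j j')))
                                 (sum-cong-≋ λ j → *-distribˡ-sum (d i) (f i j))) ⟩
    sum (λ i → sum (λ j → sum (λ j' → d i * f i j j')))
      ≈⟨ trans (∑-comm (λ i j → sum (λ j' → d i * f i j j')))
               (sum-cong-≋ λ j → ∑-comm (λ i j' → d i * f i j j')) ⟩
    sum (λ j → sum (λ j' → sum (λ i → d i * ((A i j * B j l) * (A i j' * B j' l')))))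
      ≈⟨ sum-cong-≋ (λ j → sum-cong-≋ λ j' → trans
           (sum-cong-≋ λ i → solve 5 (λ x y z u w → x ⊕ ((y ⊕ z) ⊕ (u ⊕ w)) ⊜ (z ⊕ w) ⊕ (x ⊕ (y ⊕ u)))
                                       refl (d i) (A i j) (B j l) (A i j') (B j' l'))
           (sym (*-distribˡ-sum (B j l * B j' l') (λ i → d i * (A i j * A i j'))))) ⟩
    sum (λ j → sum (λ j' → (B j l * B j' l') * gram d A j j')) ∎
    where
    f : Fin m → Fin p → Fin p → Carrier
    f i j j' = (A i j * B j l) * (A i j' * B j' l')

  gram-·-diagonal : (d : Fin m → Carrier) (A : Matrix m p) {e : Fin p → Carrier} →
                    Diagonalises d A e → (B : Matrix p q) →
                    ∀ l l' → gram d (A · B) l l' ≈ gram e B l l'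
  gram-·-diagonal d A {e} A-diag B l l' = begin
    gram d (A · B) l l'                                              ≈⟨ gram-· d A B l l' ⟩
    sum (λ j → sum (λ j' → (B j l * B j' l') * gram d A j j'))
      ≈⟨ sum-cong-≋ (λ j → sum-cong-≋ λ j' → *-congˡ (A-diag j j')) ⟩
    sum (λ j → sum (λ j' → (B j l * B j' l') * (δ j j' * e j)))
      ≈⟨ sum-cong-≋ (λ j → sum-cong-≋ λ j' →
           solve 4 (λ x y z w → (x ⊕ y) ⊕ (z ⊕ w) ⊜ z ⊕ (w ⊕ (x ⊕ y))) refl
                   (B j l) (B j' l') (δ j j') (e j)) ⟩
    sum (λ j → sum (λ j' → δ j j' * (e j * (B j l * B j' l'))))
      ≈⟨ sum-cong-≋ (λ j → sum-δ j (λ j' → e j * (B j l * B j' l'))) ⟩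
    gram e B l l'                                                    ∎

  inverse-· : {A : Matrix m p} {A' : Matrix p m} {B : Matrix p q} {B' : Matrix q p} →
              Inverse A A' → Inverse B B' → Inverse (A · B) (B' · A')
  inverse-· {m} {p} {q} {A} {A'} {B} {B'} AA' BB' i i' = begin
    sum (λ l → (A · B) i l * (B' · A') l i')
      ≈⟨ sum-cong-≋ (λ l → sum-* (λ j → A i j * B j l) (λ k → B' l k * A' k i')) ⟩
    sum (λ l → sum (λ j → sum (λ k → f l j k)))
      ≈⟨ trans (∑-comm (λ l j → sum (λ k → f l j k))) (sum-cong-≋ λ j → ∑-comm (λ l k → f l j k)) ⟩
    sum (λ j → sum (λ k → sum (λ l → (A i j * B j l) * (B' l k * A' k i'))))
      ≈⟨ sum-cong-≋ (λ j → sum-cong-≋ λ k → trans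
           (sum-cong-≋ λ l → solve 4 (λ x y z w → (x ⊕ y) ⊕ (z ⊕ w) ⊜ (x ⊕ w) ⊕ (y ⊕ z))
                                     refl (A i j) (B j l) (B' l k) (A' k i'))
           (sym (*-distribˡ-sum (A i j * A' k i') (λ l → B j l * B' l k)))) ⟩
    sum (λ j → sum (λ k → (A i j * A' k i') * (B · B') j k))
      ≈⟨ sum-cong-≋ (λ j → sum-cong-≋ λ k → trans (*-congˡ (BB' j k)) (*-comm _ _)) ⟩
    sum (λ j → sum (λ k → δ j k * (A i j * A' k i')))
      ≈⟨ sum-cong-≋ (λ j → sum-δ j (λ k → A i j * A' k i')) ⟩
    (A · A') i i'                                                    ≈⟨ AA' i i' ⟩
    δ i i'                                                           ∎
    where
    f : Fin q → Fin p → Fin p → Carrier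
    f l j k = (A i j * B j l) * (B' l k * A' k i')

  iso-refl : (d : Fin m → Carrier) → Iso d d
  iso-refl d = record
    { P = δ ; P⁻¹ = δ ; diagonalises = diagonalises-δ d ; P·P⁻¹ = inverse-δ ; P⁻¹·P = inverse-δ }

  iso-trans : {d : Fin m → Carrier} {e : Fin p → Carrier} {f : Fin q → Carrier} →
              Iso d e → Iso e f → Iso d f
  iso-trans {d = d} d≅e e≅f = record
    { P = P d≅e · P e≅f
    ; P⁻¹ = P⁻¹ e≅f · P⁻¹ d≅e
    ; diagonalises = λ l l' →
        trans (gram-·-diagonal d (P d≅e) (diagonalises d≅e) (P e≅f) l l') (diagonalises e≅f l l')
    ; P·P⁻¹ = inverse-· {A = P d≅e} {P⁻¹ d≅e} {P e≅f} {P⁻¹ e≅f} (P·P⁻¹ d≅e) (P·P⁻¹ e≅f)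
    ; P⁻¹·P = inverse-· {A = P⁻¹ e≅f} {P e≅f} {P⁻¹ d≅e} {P d≅e} (P⁻¹·P e≅f) (P⁻¹·P d≅e)
    }

  iso-sym : {d : Fin m → Carrier} {e : Fin p → Carrier} → Iso d e → Iso e d
  iso-sym {d = d} {e} d≅e = record
    { P = P⁻¹ d≅e
    ; P⁻¹ = P d≅e
    ; diagonalises = λ j j' → begin
        gram e (P⁻¹ d≅e) j j'           ≈⟨ gram-·-diagonal d (P d≅e) (diagonalises d≅e) (P⁻¹ d≅e) j j' ⟨
        gram d (P d≅e · P⁻¹ d≅e) j j'   ≈⟨ gram-cong d (P·P⁻¹ d≅e) j j' ⟩
        gram d δ j j'                   ≈⟨ diagonalises-δ d j j' ⟩
        δ j j' * d j                    ∎
    ; P·P⁻¹ = P⁻¹·P d≅e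
    ; P⁻¹·P = P·P⁻¹ d≅e
    }

  iso-congˡ : {d d' : Fin m → Carrier} {e : Fin p → Carrier} →
              (∀ i → d i ≈ d' i) → Iso d e → Iso d' e
  iso-congˡ d≈d' d≅e = record
    { P = P d≅e ; P⁻¹ = P⁻¹ d≅e ; P·P⁻¹ = P·P⁻¹ d≅e ; P⁻¹·P = P⁻¹·P d≅e
    ; diagonalises = λ j j' → trans (sum-cong-≋ λ i → *-congʳ (sym (d≈d' i))) (diagonalises d≅e j j') }

  iso-congʳ : {d : Fin m → Carrier} {e e' : Fin p → Carrier} →
              (∀ j → e j ≈ e' j) → Iso d e → Iso d e'
  iso-congʳ e≈e' d≅e = record
    { P = P d≅e ; P⁻¹ = P⁻¹ d≅e ; P·P⁻¹ = P·P⁻¹ d≅e ; P⁻¹·P = P⁻¹·P d≅e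
    ; diagonalises = λ j j' → trans (diagonalises d≅e j j') (*-congˡ (e≈e' j)) }

  iso-scale : (a : Carrier) {d : Fin m → Carrier} {e : Fin p → Carrier} →
              Iso d e → Iso (λ i → a * d i) (λ j → a * e j)
  iso-scale a {d} {e} d≅e = record
    { P = P d≅e ; P⁻¹ = P⁻¹ d≅e ; P·P⁻¹ = P·P⁻¹ d≅e ; P⁻¹·P = P⁻¹·P d≅e
    ; diagonalises = λ j j' → begin
        sum (λ i → (a * d i) * (P d≅e i j * P d≅e i j'))  ≈⟨ sum-cong-≋ (λ i → *-assoc a (d i) _) ⟩
        sum (λ i → a * (d i * (P d≅e i j * P d≅e i j')))
          ≈⟨ *-distribˡ-sum a (λ i → d i * (P d≅e i j * P d≅e i j')) ⟨
        a * gram d (P d≅e) j j'                         ≈⟨ *-congˡ (diagonalises d≅e j j') ⟩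
        a * (δ j j' * e j)
          ≈⟨ solve 3 (λ x y z → x ⊕ (y ⊕ z) ⊜ y ⊕ (x ⊕ z)) refl a (δ j j') (e j) ⟩
        δ j j' * (a * e j)                              ∎
    }

  iso-reindex : ∀ {m' p'} (m'≡m : m' ≡ m) (p'≡p : p' ≡ p) {d : Fin m → Carrier} {e : Fin p → Carrier} →
                Iso d e → Iso (d ∘ cast m'≡m) (e ∘ cast p'≡p)
  iso-reindex ≡.refl ≡.refl {d} {e} d≅e =
    iso-congʳ (λ j → reflexive (≡.cong e (≡.sym (Finₚ.cast-is-id ≡.refl j))))
      (iso-congˡ (λ i → reflexive (≡.cong d (≡.sym (Finₚ.cast-is-id ≡.refl i)))) d≅e)

  δ-adjoint : (σ τ : Fin m → Fin m) → (∀ i → σ (τ i) ≡ i) → (∀ i → τ (σ i) ≡ i) →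
              ∀ i j → δ i (σ j) ≈ δ (τ i) j
  δ-adjoint σ τ στ τσ i j = δ-cong {i = i} {σ j} (λ i≡σj → ≡.trans (≡.cong τ i≡σj) (τσ j))
                                               (λ τi≡j → ≡.trans (≡.sym (στ i)) (≡.cong σ τi≡j))

  permutation-inverse : (σ τ : Fin m → Fin m) → (∀ i → σ (τ i) ≡ i) → (∀ i → τ (σ i) ≡ i) →
                        Inverse (λ i j → δ i (σ j)) (λ j i → δ j (τ i))
  permutation-inverse σ τ στ τσ i i' = begin
    sum (λ j → δ i (σ j) * δ j (τ i'))  ≈⟨ sum-cong-≋ (λ j → *-congʳ (δ-adjoint σ τ στ τσ i j)) ⟩
    sum (λ j → δ (τ i) j * δ j (τ i'))  ≈⟨ sum-δ (τ i) (λ j → δ j (τ i')) ⟩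
    δ (τ i) (τ i')                      ≈⟨ δ-adjoint σ τ στ τσ i (τ i') ⟨
    δ i (σ (τ i'))                      ≡⟨ ≡.cong (δ i) (στ i') ⟩
    δ i i'                              ∎

  iso-permute : (σ τ : Fin m → Fin m) → (∀ i → σ (τ i) ≡ i) → (∀ i → τ (σ i) ≡ i) →
                (d : Fin m → Carrier) → Iso d (d ∘ σ)
  iso-permute σ τ στ τσ d = record
    { P = λ i j → δ i (σ j)
    ; P⁻¹ = λ j i → δ j (τ i)
    ; diagonalises = λ j j' → begin
        gram d (λ i j → δ i (σ j)) j j'  ≈⟨ diagonalises-δ d (σ j) (σ j') ⟩
        δ (σ j) (σ j') * d (σ j)         ≈⟨ *-congʳ (δ-adjoint σ τ στ τσ (σ j) j') ⟩
        δ (τ (σ j)) j' * d (σ j)         ≡⟨ ≡.cong (λ x → δ x j' * d (σ j)) (τσ j) ⟩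
        δ j j' * d (σ j)                 ∎
    ; P·P⁻¹ = permutation-inverse σ τ στ τσ
    ; P⁻¹·P = permutation-inverse τ σ τσ στ
    }

  _⊞_ : Carrier → Matrix m p → Matrix (suc m) (suc p)
  (s ⊞ M) zero    zero    = s
  (s ⊞ M) zero    (suc j) = 0#
  (s ⊞ M) (suc i) zero    = 0#
  (s ⊞ M) (suc i) (suc j) = M i j

  private
    x*[0*y]≈0 : ∀ x y → x * (0# * y) ≈ 0#
    x*[0*y]≈0 x y = trans (*-congˡ (zeroˡ y)) (zeroʳ x)

    x*[y*0]≈0 : ∀ x y → x * (y * 0#) ≈ 0#
    x*[y*0]≈0 x y = trans (*-congˡ (zeroʳ y)) (zeroʳ x)

    x+0≈ : ∀ {x y z} → x ≈ z → y ≈ 0# → x + y ≈ z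
    x+0≈ x≈z y≈0 = trans (+-cong x≈z y≈0) (+-identityʳ _)

    0+y≈ : ∀ {x y z} → x ≈ 0# → y ≈ z → x + y ≈ z
    0+y≈ x≈0 y≈z = trans (+-cong x≈0 y≈z) (+-identityˡ _)

  inverse-⊕ : {s t : Carrier} {M : Matrix m p} {N : Matrix p m} →
              s * t ≈ 1# → Inverse M N → Inverse (s ⊞ M) (t ⊞ N)
  inverse-⊕ {p = p} st≈1 MN zero    zero     = x+0≈ st≈1 (sum-zero {p} λ _ → zeroˡ 0#)
  inverse-⊕ {t = t} {N = N} st≈1 MN zero (suc i') = x+0≈ (zeroʳ _) (sum-zero λ j → zeroˡ (N j i'))
  inverse-⊕ {t = t} {M = M} st≈1 MN (suc i) zero = x+0≈ (zeroˡ t) (sum-zero λ j → zeroʳ (M i j))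
  inverse-⊕ st≈1 MN (suc i) (suc i') = 0+y≈ (zeroˡ 0#) (trans (MN i i') (sym (δ-suc i i')))

  iso-∷ : {a a' : Carrier} {φ ψ : Form} (s t : Carrier) → s * t ≈ 1# → a' ≈ a * (s * s) →
          Iso (coeff φ) (coeff ψ) → Iso (coeff (a ∷ φ)) (coeff (a' ∷ ψ))
  iso-∷ {a} {a'} {φ} {ψ} s t st≈1 a'≈ass φ≅ψ = record
    { P = s ⊞ P φ≅ψ
    ; P⁻¹ = t ⊞ P⁻¹ φ≅ψ
    ; diagonalises = diag
    ; P·P⁻¹ = inverse-⊕ st≈1 (P·P⁻¹ φ≅ψ)
    ; P⁻¹·P = inverse-⊕ (trans (*-comm t s) st≈1) (P⁻¹·P φ≅ψ)
    }
    where
    M = P φ≅ψ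
    diag : Diagonalises (coeff (a ∷ φ)) (s ⊞ M) (coeff (a' ∷ ψ))
    diag zero zero = x+0≈ (trans (sym a'≈ass) (sym (*-identityˡ a')))
                          (sum-zero λ i → x*[0*y]≈0 (coeff φ i) 0#)
    diag zero (suc j') = x+0≈ (trans (x*[y*0]≈0 a s) (sym (zeroˡ _)))
                              (sum-zero λ i → x*[0*y]≈0 (coeff φ i) (M i j'))
    diag (suc j) zero = x+0≈ (trans (x*[0*y]≈0 a s) (sym (zeroˡ _)))
                             (sum-zero λ i → x*[y*0]≈0 (coeff φ i) (M i j))
    diag (suc j) (suc j') = 0+y≈ (x*[0*y]≈0 a 0#)
                                 (trans (diagonalises φ≅ψ j j') (*-congʳ (sym (δ-suc j j'))))

  iso-swap : (a b : Carrier) (φ : Form) → Iso (coeff (a ∷ b ∷ φ)) (coeff (b ∷ a ∷ φ))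
  iso-swap a b φ =
    iso-congʳ (λ k → reflexive (swapped k))
      (iso-permute (transpose zero (suc zero)) (transpose (suc zero) zero)
                   (λ _ → transpose-inverse zero (suc zero)) (λ _ → transpose-inverse (suc zero) zero)
                   (coeff (a ∷ b ∷ φ)))
    where
    swapped : ∀ k → coeff (a ∷ b ∷ φ) (transpose zero (suc zero) k) ≡ coeff (b ∷ a ∷ φ) k
    swapped zero = ≡.refl
    swapped (suc zero) = ≡.refl
    swapped (suc (suc k)) = ≡.refl


module DiagonalForms {c ℓ : Level} (F : Field c ℓ) where
  open Field F hiding (zero)
  open QuadraticForms F
  open Matrices F
  open Iso
  open import Algebra.Properties.Semiring.Sum semiring using (sum)
  module ≈-Reasoning = SetoidReasoning setoid

  -- φ ≅ ψ, wrapped in a record so that φ and ψ can be inferred from it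
  infix 4 _≃_
  record _≃_ (φ ψ : Form) : Set (c ⊔ ℓ) where
    constructor ≅⇒≃
    field ≃⇒≅ : φ ≅ ψ
  open _≃_ public

  Iso⇒≃ : {φ ψ : Form} → Iso (coeff φ) (coeff ψ) → φ ≃ ψ
  Iso⇒≃ {φ} φ≅ψ = ≅⇒≃
    ( M , N
    , (λ j j' → trans (reflexive (sumF≡sum λ i → coeff φ i * (M i j * M i j'))) (diagonalises φ≅ψ j j'))
    , (λ i i' → trans (reflexive (sumF≡sum λ j → M i j * N j i')) (P·P⁻¹ φ≅ψ i i'))
    , (λ j j' → trans (reflexive (sumF≡sum λ i → N j i * M i j')) (P⁻¹·P φ≅ψ j j')) )
    where M = P φ≅ψ ; N = P⁻¹ φ≅ψ

  ≃⇒Iso : {φ ψ : Form} → φ ≃ ψ → Iso (coeff φ) (coeff ψ)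
  ≃⇒Iso {φ} (≅⇒≃ (M , N , diag , MN , NM)) = record
    { P = M
    ; P⁻¹ = N
    ; diagonalises = λ j j' →
        trans (reflexive (≡.sym (sumF≡sum λ i → coeff φ i * (M i j * M i j')))) (diag j j')
    ; P·P⁻¹ = λ i i' → trans (reflexive (≡.sym (sumF≡sum λ j → M i j * N j i'))) (MN i i')
    ; P⁻¹·P = λ j j' → trans (reflexive (≡.sym (sumF≡sum λ i → N j i * M i j'))) (NM j j')
    }

  ≃-refl : {φ : Form} → φ ≃ φ
  ≃-refl {φ} = Iso⇒≃ (iso-refl (coeff φ))

  ≃-reflexive : {φ ψ : Form} → φ ≡ ψ → φ ≃ ψ
  ≃-reflexive ≡.refl = ≃-refl

  ≃-sym : {φ ψ : Form} → φ ≃ ψ → ψ ≃ φ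
  ≃-sym φ≃ψ = Iso⇒≃ (iso-sym (≃⇒Iso φ≃ψ))

  ≃-trans : {φ ψ χ : Form} → φ ≃ ψ → ψ ≃ χ → φ ≃ χ
  ≃-trans φ≃ψ ψ≃χ = Iso⇒≃ (iso-trans (≃⇒Iso φ≃ψ) (≃⇒Iso ψ≃χ))

  ≃-setoid : Setoid c (c ⊔ ℓ)
  ≃-setoid = record
    { Carrier = Form
    ; _≈_ = _≃_
    ; isEquivalence = record { refl = ≃-refl ; sym = ≃-sym ; trans = ≃-trans }
    }

  module ≃-Reasoning = SetoidReasoning ≃-setoid

  Nonzero : Set (c ⊔ ℓ)
  Nonzero = Σ Carrier λ a → ¬ (a ≈ 0#)

  1≉0 : ¬ (1# ≈ 0#)
  1≉0 1≈0 = 0≉1 (sym 1≈0)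

  *-nonzero : {a b : Carrier} → ¬ (a ≈ 0#) → ¬ (b ≈ 0#) → ¬ (a * b ≈ 0#)
  *-nonzero {a} {b} a≉0 b≉0 ab≈0 with inverse b b≉0
  ... | b⁻¹ , bb⁻¹≈1 = a≉0 (begin
    a              ≈⟨ *-identityʳ a ⟨
    a * 1#         ≈⟨ *-congˡ bb⁻¹≈1 ⟨
    a * (b * b⁻¹)  ≈⟨ *-assoc a b b⁻¹ ⟨
    (a * b) * b⁻¹  ≈⟨ *-congʳ ab≈0 ⟩
    0# * b⁻¹       ≈⟨ zeroˡ b⁻¹ ⟩
    0#             ∎)
    where open ≈-Reasoning

  SquareMultiple : Carrier → Carrier → Set (c ⊔ ℓ)
  SquareMultiple u v = Σ Carrier λ s → ¬ (s ≈ 0#) × (v ≈ u * (s * s))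

  ≈⇒SquareMultiple : {u v : Carrier} → u ≈ v → SquareMultiple u v
  ≈⇒SquareMultiple {u} u≈v =
    1# , 1≉0 , trans (sym u≈v) (sym (trans (*-congˡ (*-identityˡ 1#)) (*-identityʳ u)))

  ∷-≃ : {a a' : Carrier} {φ ψ : Form} → SquareMultiple a a' → φ ≃ ψ → (a ∷ φ) ≃ (a' ∷ ψ)
  ∷-≃ (s , s≉0 , a'≈ass) φ≃ψ with inverse s s≉0
  ... | t , st≈1 = Iso⇒≃ (iso-∷ s t st≈1 a'≈ass (≃⇒Iso φ≃ψ))

  rescale⇒≃ : {φ ψ : Form} → Pointwise SquareMultiple φ ψ → φ ≃ ψ
  rescale⇒≃ []           = ≃-refl
  rescale⇒≃ (a~a' ∷ φ~ψ) = ∷-≃ a~a' (rescale⇒≃ φ~ψ)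

  map-rescale : {f g : Carrier → Carrier} → (∀ x → SquareMultiple (f x) (g x)) →
                (φ : Form) → map f φ ≃ map g φ
  map-rescale {f} {g} fg φ = rescale⇒≃ (Pointwiseₚ.map⁺ f g (Pointwiseₚ.refl (fg _)))

  ∷-congˡ : (a : Carrier) {φ ψ : Form} → φ ≃ ψ → (a ∷ φ) ≃ (a ∷ ψ)
  ∷-congˡ a = ∷-≃ (≈⇒SquareMultiple refl)

  ↭⇒≃ : {φ ψ : Form} → φ ↭ ψ → φ ≃ ψ
  ↭⇒≃ ↭.refl                   = ≃-refl
  ↭⇒≃ (↭.prep a φ↭ψ)           = ∷-congˡ a (↭⇒≃ φ↭ψ)
  ↭⇒≃ (↭.swap {xs = φ} a b φ↭ψ) = ≃-trans (Iso⇒≃ (iso-swap a b φ)) (∷-congˡ b (∷-congˡ a (↭⇒≃ φ↭ψ)))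
  ↭⇒≃ (↭.trans φ↭χ χ↭ψ)        = ≃-trans (↭⇒≃ φ↭χ) (↭⇒≃ χ↭ψ)

  ++-congˡ : (χ : Form) {φ ψ : Form} → φ ≃ ψ → (χ ++ φ) ≃ (χ ++ ψ)
  ++-congˡ []      φ≃ψ = φ≃ψ
  ++-congˡ (a ∷ χ) φ≃ψ = ∷-congˡ a (++-congˡ χ φ≃ψ)

  ++-cong : {φ φ' ψ ψ' : Form} → φ ≃ φ' → ψ ≃ ψ' → (φ ++ ψ) ≃ (φ' ++ ψ')
  ++-cong {φ} {φ'} {ψ} {ψ'} φ≃φ' ψ≃ψ' = begin
    φ ++ ψ    ≈⟨ ↭⇒≃ (↭ₚ.++-comm φ ψ) ⟩
    ψ ++ φ    ≈⟨ ++-congˡ ψ φ≃φ' ⟩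
    ψ ++ φ'   ≈⟨ ↭⇒≃ (↭ₚ.++-comm ψ φ') ⟩
    φ' ++ ψ   ≈⟨ ++-congˡ φ' ψ≃ψ' ⟩
    φ' ++ ψ'  ∎
    where open ≃-Reasoning

  map-≃ : {f : Carrier → Carrier} (a : Carrier) → (∀ x → f x ≈ a * x) →
          {φ ψ : Form} → φ ≃ ψ → map f φ ≃ map f ψ
  map-≃ {f} a f≈a* {φ} {ψ} φ≃ψ =
    Iso⇒≃ (iso-congˡ (λ i → sym (Pointwiseₚ.lookup⁺ (f≈a*-pointwise φ) i))
           (iso-congʳ (λ j → sym (Pointwiseₚ.lookup⁺ (f≈a*-pointwise ψ) j))
            (iso-reindex (Pointwiseₚ.Pointwise-length (f≈a*-pointwise φ))
                         (Pointwiseₚ.Pointwise-length (f≈a*-pointwise ψ))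
                         (iso-scale a (≃⇒Iso φ≃ψ)))))
    where
    f≈a*-pointwise : (χ : Form) → Pointwise (λ u' u → u' ≈ a * u) (map f χ) χ
    f≈a*-pointwise []      = []
    f≈a*-pointwise (x ∷ χ) = f≈a* x ∷ f≈a*-pointwise χ

  concatMap-≃ : ∀ {a} {A : Set a} {f g : A → Form} → (∀ x → f x ≃ g x) → (xs : List A) →
                concatMap f xs ≃ concatMap g xs
  concatMap-≃ f≃g []       = ≃-refl
  concatMap-≃ f≃g (x ∷ xs) = ++-cong (f≃g x) (concatMap-≃ f≃g xs)

module PfisterSums {c ℓ : Level} (F : Field c ℓ) where
  open Field F hiding (zero)
  open QuadraticForms F
  open DiagonalForms F
  open import Algebra.Solver.CommutativeMonoid *-commutativeMonoid using (solve; _⊜_; _⊕_)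

  private variable
    n : ℕ

  GPDatum : ℕ → Set (c ⊔ ℓ)
  GPDatum n = Nonzero × Units n

  gp : GPDatum n → Form
  gp ((a , _) , as) = ⟨ a ⟩ ⊗ pfister as

  gp∈GP : (g : GPDatum n) → InGP n (gp g)
  gp∈GP g@((a , a≉0) , as) = a , a≉0 , as , ≃⇒≅ (≃-refl {gp g})

  ⟨⟩-⊗ : (a : Carrier) (ψ : Form) → ⟨ a ⟩ ⊗ ψ ≡ map (a *_) ψ
  ⟨⟩-⊗ a ψ = Listₚ.++-identityʳ (map (a *_) ψ)

  ∷-⊗ : (a : Carrier) (φ ψ : Form) → (a ∷ φ) ⊗ ψ ≡ ⟨ a ⟩ ⊗ ψ ++ φ ⊗ ψ
  ∷-⊗ a φ ψ = Listₚ.concatMap-++ (λ b → map (b *_) ψ) ⟨ a ⟩ φ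

  ∷-∷-⊗ : (a b : Carrier) (φ ψ : Form) → (a ∷ b ∷ φ) ⊗ ψ ≡ (a ∷ b ∷ []) ⊗ ψ ++ φ ⊗ ψ
  ∷-∷-⊗ a b φ ψ = Listₚ.concatMap-++ (λ b → map (b *_) ψ) (a ∷ b ∷ []) φ

  ⊗-[] : (φ : Form) → φ ⊗ [] ≡ []
  ⊗-[] []      = ≡.refl
  ⊗-[] (a ∷ φ) = ⊗-[] φ

  ⊗-congʳ : (φ : Form) {ψ ψ' : Form} → ψ ≃ ψ' → φ ⊗ ψ ≃ φ ⊗ ψ'
  ⊗-congʳ []      ψ≃ψ' = ≃-refl
  ⊗-congʳ (a ∷ φ) ψ≃ψ' = ++-cong (map-≃ a (λ _ → refl) ψ≃ψ') (⊗-congʳ φ ψ≃ψ')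

  ⊗-distribˡ-++ : (φ ψ χ : Form) → φ ⊗ (ψ ++ χ) ↭ φ ⊗ ψ ++ φ ⊗ χ
  ⊗-distribˡ-++ []      ψ χ = ↭.refl
  ⊗-distribˡ-++ (a ∷ φ) ψ χ = begin
    map (a *_) (ψ ++ χ) ++ φ ⊗ (ψ ++ χ)  ≡⟨ ≡.cong (_++ φ ⊗ (ψ ++ χ)) (Listₚ.map-++ (a *_) ψ χ) ⟩
    (aψ ++ aχ) ++ φ ⊗ (ψ ++ χ)            ↭⟨ ↭ₚ.++⁺ˡ (aψ ++ aχ) (⊗-distribˡ-++ φ ψ χ) ⟩
    (aψ ++ aχ) ++ (φ ⊗ ψ ++ φ ⊗ χ)        ≡⟨ Listₚ.++-assoc aψ aχ _ ⟩
    aψ ++ (aχ ++ (φ ⊗ ψ ++ φ ⊗ χ))        ↭⟨ ↭ₚ.++⁺ˡ aψ (↭ₚ.shifts aχ (φ ⊗ ψ)) ⟩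
    aψ ++ (φ ⊗ ψ ++ (aχ ++ φ ⊗ χ))        ≡⟨ Listₚ.++-assoc aψ (φ ⊗ ψ) _ ⟨
    (aψ ++ φ ⊗ ψ) ++ (aχ ++ φ ⊗ χ)        ∎
    where
    open ↭.PermutationReasoning
    aψ = map (a *_) ψ
    aχ = map (a *_) χ

  scaleGP : Nonzero → GPDatum n → GPDatum n
  scaleGP (a , a≉0) ((b , b≉0) , as) = (a * b , *-nonzero a≉0 b≉0) , as

  ⟨⟩-⊗-gp : (a : Nonzero) (g : GPDatum n) → ⟨ proj₁ a ⟩ ⊗ gp g ≃ gp (scaleGP a g)
  ⟨⟩-⊗-gp (a , _) ((b , _) , as) = begin
    ⟨ a ⟩ ⊗ (⟨ b ⟩ ⊗ Q)            ≡⟨ ≡.trans (⟨⟩-⊗ a _) (≡.cong (map (a *_)) (⟨⟩-⊗ b Q)) ⟩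
    map (a *_) (map (b *_) Q)     ≡⟨ Listₚ.map-∘ Q ⟨
    map (λ q → a * (b * q)) Q     ≈⟨ map-rescale (λ q → ≈⇒SquareMultiple (sym (*-assoc a b q))) Q ⟩
    map ((a * b) *_) Q            ≡⟨ ⟨⟩-⊗ (a * b) Q ⟨
    ⟨ a * b ⟩ ⊗ Q                 ∎
    where
    open ≃-Reasoning
    Q = pfister as

  binary-⊗ : {a : Carrier} → ¬ (a ≈ 0#) → (b : Carrier) (ψ : Form) →
             (a ∷ b ∷ []) ⊗ ψ ≃ ⟨ a ⟩ ⊗ ((1# ∷ a * b ∷ []) ⊗ ψ)
  binary-⊗ {a} a≉0 b ψ = begin
    (a ∷ b ∷ []) ⊗ ψ
      ≡⟨ pair-⊗ a b ψ ⟩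
    map (a *_) ψ ++ map (b *_) ψ
      ≈⟨ ++-cong (map-rescale (λ q → ≈⇒SquareMultiple (*-congˡ (sym (*-identityˡ q)))) ψ)
                 (map-rescale (λ q → a , a≉0 , b*q≈ q) ψ) ⟩
    map (λ q → a * (1# * q)) ψ ++ map (λ q → a * ((a * b) * q)) ψ
      ≡⟨ ≡.cong₂ _++_ (Listₚ.map-∘ ψ) (Listₚ.map-∘ ψ) ⟩
    map (a *_) (map (1# *_) ψ) ++ map (a *_) (map ((a * b) *_) ψ)
      ≡⟨ Listₚ.map-++ (a *_) (map (1# *_) ψ) _ ⟨
    map (a *_) (map (1# *_) ψ ++ map ((a * b) *_) ψ)
      ≡⟨ ≡.cong (map (a *_)) (pair-⊗ 1# (a * b) ψ) ⟨
    map (a *_) ((1# ∷ a * b ∷ []) ⊗ ψ)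
      ≡⟨ ⟨⟩-⊗ a _ ⟨
    ⟨ a ⟩ ⊗ ((1# ∷ a * b ∷ []) ⊗ ψ)
      ∎
    where
    open ≃-Reasoning
    pair-⊗ : (u v : Carrier) (χ : Form) → (u ∷ v ∷ []) ⊗ χ ≡ map (u *_) χ ++ map (v *_) χ
    pair-⊗ u v χ = ≡.cong (map (u *_) χ ++_) (Listₚ.++-identityʳ (map (v *_) χ))
    b*q≈ : ∀ q → a * ((a * b) * q) ≈ (b * q) * (a * a)
    b*q≈ q = solve 3 (λ x y z → x ⊕ ((x ⊕ y) ⊕ z) ⊜ (y ⊕ z) ⊕ (x ⊕ x)) refl a b q

  SumOfGP : ℕ → Form → Set (c ⊔ ℓ)
  SumOfGP n ψ = Σ (List (GPDatum n)) λ gs → ψ ≃ concatMap gp gs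

  SumOfGP-resp : {ψ ψ' : Form} → ψ ≃ ψ' → SumOfGP n ψ' → SumOfGP n ψ
  SumOfGP-resp ψ≃ψ' (gs , ψ'≃) = gs , ≃-trans ψ≃ψ' ψ'≃

  []-SumOfGP : SumOfGP n []
  []-SumOfGP = [] , ≃-refl

  gp-SumOfGP : {ψ : Form} (g : GPDatum n) → ψ ≃ gp g → SumOfGP n ψ
  gp-SumOfGP g ψ≃gp = g ∷ [] , ≃-trans ψ≃gp (≃-reflexive (≡.sym (Listₚ.++-identityʳ (gp g))))

  ++-SumOfGP : {ψ χ : Form} → SumOfGP n ψ → SumOfGP n χ → SumOfGP n (ψ ++ χ)
  ++-SumOfGP (gs , ψ≃) (hs , χ≃) =
    gs ++ hs , ≃-trans (++-cong ψ≃ χ≃) (≃-reflexive (≡.sym (Listₚ.concatMap-++ gp gs hs)))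

  ⊗-SumOfGP : ∀ {m} (φ : Form) {ψ : Form} → (∀ g → SumOfGP m (φ ⊗ gp g)) → SumOfGP n ψ → SumOfGP m (φ ⊗ ψ)
  ⊗-SumOfGP {n} {m} φ φ⊗gp (gs , ψ≃) = SumOfGP-resp (⊗-congʳ φ ψ≃) (⊗-sum gs)
    where
    ⊗-sum : (gs : List (GPDatum n)) → SumOfGP m (φ ⊗ concatMap gp gs)
    ⊗-sum []       = SumOfGP-resp (≃-reflexive (⊗-[] φ)) []-SumOfGP
    ⊗-sum (g ∷ gs) = SumOfGP-resp (↭⇒≃ (⊗-distribˡ-++ φ (gp g) (concatMap gp gs)))
                                  (++-SumOfGP (φ⊗gp g) (⊗-sum gs))

  diagonal-⊗-SumOfGP : {r ψ : Form} → Nondeg r → SumOfGP n ψ → SumOfGP n (r ⊗ ψ)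
  diagonal-⊗-SumOfGP {r = []}    []           _ = []-SumOfGP
  diagonal-⊗-SumOfGP {r = a ∷ r} {ψ} (a≉0 ∷ nd) S =
    SumOfGP-resp (≃-reflexive (∷-⊗ a r ψ))
      (++-SumOfGP (⊗-SumOfGP ⟨ a ⟩ (λ g → gp-SumOfGP (scaleGP (a , a≉0) g) (⟨⟩-⊗-gp (a , a≉0) g)) S)
                  (diagonal-⊗-SumOfGP nd S))

  -- ⟨c, d⟩ ⊗ b⟨⟨as⟩⟩ ≅ ⟨cb, db⟩ ⊗ ⟨⟨as⟩⟩ ≅ cb⟨⟨cb·db, as⟩⟩
  binaryGP : Nonzero → Nonzero → GPDatum n → GPDatum (suc n)
  binaryGP (c , c≉0) (d , d≉0) ((b , b≉0) , as) =
    (c * b , cb≉0) , (c * b * (d * b) , *-nonzero cb≉0 (*-nonzero d≉0 b≉0)) ∷ᵛ as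
    where cb≉0 = *-nonzero c≉0 b≉0

  binary-⊗-gp : (c d : Nonzero) (g : GPDatum n) → (proj₁ c ∷ proj₁ d ∷ []) ⊗ gp g ≃ gp (binaryGP c d g)
  binary-⊗-gp (c , c≉0) (d , d≉0) g@((b , b≉0) , as) = begin
    (c ∷ d ∷ []) ⊗ gp g                       ≡⟨ Listₚ.concatMap-++ (λ u → map (u *_) (gp g)) ⟨ c ⟩ ⟨ d ⟩ ⟩
    ⟨ c ⟩ ⊗ gp g ++ ⟨ d ⟩ ⊗ gp g              ≈⟨ ++-cong (⟨⟩-⊗-gp (c , c≉0) g) (⟨⟩-⊗-gp (d , d≉0) g) ⟩
    ⟨ c * b ⟩ ⊗ Q ++ ⟨ d * b ⟩ ⊗ Q            ≡⟨ Listₚ.concatMap-++ (λ u → map (u *_) Q) ⟨ c * b ⟩ ⟨ d * b ⟩ ⟨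
    (c * b ∷ d * b ∷ []) ⊗ Q                  ≈⟨ binary-⊗ (*-nonzero c≉0 b≉0) (d * b) Q ⟩
    ⟨ c * b ⟩ ⊗ ((1# ∷ c * b * (d * b) ∷ []) ⊗ Q) ∎
    where
    open ≃-Reasoning
    Q = pfister as

  even-⊗-SumOfGP : {x ψ : Form} → Nondeg x → (k : ℕ) → length x ≡ k ℕ.+ k →
                   SumOfGP n ψ → SumOfGP (suc n) (x ⊗ ψ)
  even-⊗-SumOfGP {x = []} _ _ _ _ = []-SumOfGP
  even-⊗-SumOfGP {x = c ∷ []} _ zero ()
  even-⊗-SumOfGP {x = c ∷ []} _ (suc k) |x|≡ with ≡.trans (ℕₚ.suc-injective |x|≡) (ℕₚ.+-suc k k)
  ... | ()
  even-⊗-SumOfGP {x = c ∷ d ∷ x} {ψ} (c≉0 ∷ d≉0 ∷ nd) (suc k) |x|≡ S =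
    SumOfGP-resp (≃-reflexive (∷-∷-⊗ c d x ψ))
      (++-SumOfGP (⊗-SumOfGP (c ∷ d ∷ []) (λ g → gp-SumOfGP (binaryGP c' d' g) (binary-⊗-gp c' d' g)) S)
                  (even-⊗-SumOfGP nd k |x|≡k+k S))
    where
    c' d' : Nonzero
    c' = c , c≉0
    d' = d , d≉0
    |x|≡k+k : length x ≡ k ℕ.+ k
    |x|≡k+k = ℕₚ.suc-injective (≡.trans (ℕₚ.suc-injective |x|≡) (ℕₚ.+-suc k k))

  ValidFactors : Vec Form n → Set (c ⊔ ℓ)
  ValidFactors = Vec.foldr _ (λ x P → (Nondeg x × InI x) × P) (Lift (c ⊔ ℓ) ⊤)

  factors-SumOfGP : (xs : Vec Form n) → ValidFactors xs → SumOfGP n (⊗-prod xs)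
  factors-SumOfGP []ᵛ _ =
    gp-SumOfGP ((1# , 1≉0) , []ᵛ) (rescale⇒≃ (≈⇒SquareMultiple (sym (*-identityˡ 1#)) ∷ []))
  factors-SumOfGP (x ∷ᵛ xs) ((nd , k , |x|≡) , valid) =
    even-⊗-SumOfGP nd k |x|≡ (factors-SumOfGP xs valid)

  terms-SumOfGP : (ts : List (Term n)) → All ValidTerm ts → SumOfGP n (⊥-sum (map termForm ts))
  terms-SumOfGP []             []                   = []-SumOfGP
  terms-SumOfGP ((r , xs) ∷ ts) ((nd , valid) ∷ vs) =
    ++-SumOfGP (diagonal-⊗-SumOfGP nd (factors-SumOfGP xs valid)) (terms-SumOfGP ts vs)

module Grouping {c ℓ : Level} (F : Field c ℓ) where
  open Field F hiding (zero)
  open QuadraticForms F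
  open DiagonalForms F
  open PfisterSums F

  private variable
    n k k' : ℕ

  record Decomposition (n k : ℕ) (ψ : Form) : Set (c ⊔ ℓ) where
    field
      gpForms         : List Form
      remainder       : List (Term (suc n))
      gpForms-length  : length gpForms ℕ.≤ k
      gpForms∈GP      : All (InGP n) gpForms
      remainder-valid : All ValidTerm remainder
      split           : ψ ≃ ⊥-sum gpForms ++ ⊥-sum (map termForm remainder)
  open Decomposition

  Decomposition-resp : {ψ ψ' : Form} → ψ ≃ ψ' → Decomposition n k ψ' → Decomposition n k ψ
  Decomposition-resp ψ≃ψ' D = record
    { gpForms = gpForms D ; remainder = remainder D ; gpForms-length = gpForms-length D
    ; gpForms∈GP = gpForms∈GP D ; remainder-valid = remainder-valid D
    ; split = ≃-trans ψ≃ψ' (split D) }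

  []-Decomposition : Decomposition n k []
  []-Decomposition = record
    { gpForms = [] ; remainder = [] ; gpForms-length = ℕ.z≤n
    ; gpForms∈GP = [] ; remainder-valid = [] ; split = ≃-refl }

  gp-Decomposition : (g : GPDatum n) → Decomposition n 1 (gp g)
  gp-Decomposition g = record
    { gpForms = gp g ∷ [] ; remainder = [] ; gpForms-length = ℕ.s≤s ℕ.z≤n
    ; gpForms∈GP = gp∈GP g ∷ [] ; remainder-valid = []
    ; split = ≃-reflexive (≡.sym (≡.trans (Listₚ.++-identityʳ (gp g ++ [])) (Listₚ.++-identityʳ (gp g))))
    }

  ++-Decomposition : {ψ χ : Form} → Decomposition n k ψ → Decomposition n k' χ →
                     Decomposition n (k ℕ.+ k') (ψ ++ χ)
  ++-Decomposition {ψ = ψ} {χ} D E = record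
    { gpForms = gpForms D ++ gpForms E
    ; remainder = remainder D ++ remainder E
    ; gpForms-length = ℕₚ.≤-trans (ℕₚ.≤-reflexive (Listₚ.length-++ (gpForms D)))
                                  (ℕₚ.+-mono-≤ (gpForms-length D) (gpForms-length E))
    ; gpForms∈GP = Allₚ.++⁺ (gpForms∈GP D) (gpForms∈GP E)
    ; remainder-valid = Allₚ.++⁺ (remainder-valid D) (remainder-valid E)
    ; split = begin
        ψ ++ χ                      ≈⟨ ++-cong (split D) (split E) ⟩
        (Π ++ T) ++ (Π' ++ T')      ≈⟨ ↭⇒≃ (interchange Π T Π' T') ⟩
        (Π ++ Π') ++ (T ++ T')      ≡⟨ ≡.cong₂ _++_ (Listₚ.concat-++ (gpForms D) (gpForms E))
                                        (≡.trans (Listₚ.concat-++ (map termForm (remainder D)) _)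
                                                 (≡.cong ⊥-sum (≡.sym (Listₚ.map-++ termForm (remainder D) _)))) ⟩
        ⊥-sum (gpForms D ++ gpForms E) ++ ⊥-sum (map termForm (remainder D ++ remainder E)) ∎
    }
    where
    open ≃-Reasoning
    Π  = ⊥-sum (gpForms D)
    Π' = ⊥-sum (gpForms E)
    T  = ⊥-sum (map termForm (remainder D))
    T' = ⊥-sum (map termForm (remainder E))
    interchange : (A B C D : Form) → (A ++ B) ++ (C ++ D) ↭ (A ++ C) ++ (B ++ D)
    interchange A B C D = ↭.trans (↭ₚ.++-assoc A B (C ++ D))
      (↭.trans (↭ₚ.++⁺ˡ A (↭ₚ.shifts B C)) (↭.↭-sym (↭ₚ.++-assoc A C (B ++ D))))

  pfister-factors-valid : (as : Units n) → ValidFactors (Vec.map (λ u → 1# ∷ proj₁ u ∷ []) as)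
  pfister-factors-valid []ᵛ       = lift tt
  pfister-factors-valid (u ∷ᵛ as) = ((1≉0 ∷ proj₂ u ∷ []) , 1 , ≡.refl) , pfister-factors-valid as

  pair-Decomposition : (a b : Nonzero) (as : Units n) →
                       Decomposition n 0 (gp (a , as) ++ gp (b , as))
  pair-Decomposition {n} (a , a≉0) (b , b≉0) as = record
    { gpForms = [] ; remainder = t ∷ [] ; gpForms-length = ℕ.z≤n ; gpForms∈GP = []
    ; remainder-valid = ((a≉0 ∷ []) , pfister-factors-valid ab∷as) ∷ []
    ; split = begin
        ⟨ a ⟩ ⊗ Q ++ ⟨ b ⟩ ⊗ Q        ≡⟨ Listₚ.concatMap-++ (λ u → map (u *_) Q) ⟨ a ⟩ ⟨ b ⟩ ⟨
        (a ∷ b ∷ []) ⊗ Q             ≈⟨ binary-⊗ a≉0 b Q ⟩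
        termForm t                   ≡⟨ Listₚ.++-identityʳ (termForm t) ⟨
        [] ++ ⊥-sum (map termForm (t ∷ [])) ∎
    }
    where
    open ≃-Reasoning
    Q = pfister as
    ab∷as = (a * b , *-nonzero a≉0 b≉0) ∷ᵛ as
    t : Term (suc n)
    t = ⟨ a ⟩ , Vec.map (λ u → 1# ∷ proj₁ u ∷ []) ab∷as

  class-Decomposition : (as : Units n) (bs : List Nonzero) →
                        Decomposition n 1 (concatMap (λ b → gp (b , as)) bs)
  class-Decomposition as []           = []-Decomposition
  class-Decomposition as (b ∷ [])     =
    Decomposition-resp (≃-reflexive (Listₚ.++-identityʳ (gp (b , as)))) (gp-Decomposition (b , as))
  class-Decomposition as (b ∷ b' ∷ bs) =
    Decomposition-resp (≃-reflexive (≡.sym (Listₚ.++-assoc (gp (b , as)) (gp (b' , as)) _)))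
      (++-Decomposition (pair-Decomposition b b' as) (class-Decomposition as bs))

  classForm : Vec (Units n) k → Nonzero × Fin k → Form
  classForm ps (a , i) = gp (a , Vec.lookup ps i)

  splitClass : List (Nonzero × Fin (suc k)) → List Nonzero × List (Nonzero × Fin k)
  splitClass []                = [] , []
  splitClass ((a , zero)  ∷ L) = Product.map₁ (a ∷_) (splitClass L)
  splitClass ((a , suc i) ∷ L) = Product.map₂ ((a , i) ∷_) (splitClass L)

  splitClass-↭ : (p : Units n) (ps : Vec (Units n) k) (L : List (Nonzero × Fin (suc k))) →
                 concatMap (classForm (p ∷ᵛ ps)) L ↭
                 concatMap (λ b → gp (b , p)) (proj₁ (splitClass L)) ++
                 concatMap (classForm ps) (proj₂ (splitClass L))
  splitClass-↭ p ps [] = ↭.refl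
  splitClass-↭ p ps ((a , zero) ∷ L) =
    ↭.trans (↭ₚ.++⁺ˡ (gp (a , p)) (splitClass-↭ p ps L)) (↭.↭-sym (↭ₚ.++-assoc (gp (a , p)) _ _))
  splitClass-↭ p ps ((a , suc i) ∷ L) =
    ↭.trans (↭ₚ.++⁺ˡ (classForm ps (a , i)) (splitClass-↭ p ps L))
            (↭ₚ.shifts (classForm ps (a , i)) (concatMap (λ b → gp (b , p)) (proj₁ (splitClass L))))

  classes-Decomposition : (ps : Vec (Units n) k) (L : List (Nonzero × Fin k)) →
                          Decomposition n k (concatMap (classForm ps) L)
  classes-Decomposition []ᵛ       []  = []-Decomposition
  classes-Decomposition (p ∷ᵛ ps) L =
    Decomposition-resp (↭⇒≃ (splitClass-↭ p ps L))
      (++-Decomposition (class-Decomposition p (proj₁ (splitClass L)))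
                        (classes-Decomposition ps (proj₂ (splitClass L))))

  Covers : Vec (Units n) k → Set (c ⊔ ℓ)
  Covers {n} ps = (as : Units n) → ∃[ i ] (pfister as ≅ pfister (Vec.lookup ps i))

  classify : (ps : Vec (Units n) k) → Covers ps → GPDatum n → Nonzero × Fin k
  classify ps covers (a , as) = a , proj₁ (covers as)

  classify-≃ : (ps : Vec (Units n) k) (covers : Covers ps) (gs : List (GPDatum n)) →
               concatMap gp gs ≃ concatMap (classForm ps) (map (classify ps covers) gs)
  classify-≃ ps covers gs = ≃-trans
    (concatMap-≃ (λ where (a , as) → ⊗-congʳ ⟨ proj₁ a ⟩ (≅⇒≃ (proj₂ (covers as)))) gs)
    (≃-reflexive (≡.sym (Listₚ.concatMap-map (classForm ps) (classify ps covers) gs)))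

  Decomposition⇒SlnAtMost : (φ : Form) {ψ : Form} → φ ∼ ψ → Decomposition n k ψ → SlnAtMost n φ k
  Decomposition⇒SlnAtMost φ {ψ} (m , φ-ψ≅H) D =
    gpForms D , gpForms-length D , gpForms∈GP D , remainder D , remainder-valid D , m , ≃⇒≅ (begin
      (φ ++ neg Π) ++ neg T    ≡⟨ Listₚ.++-assoc φ (neg Π) (neg T) ⟩
      φ ++ (neg Π ++ neg T)    ≡⟨ ≡.cong (φ ++_) (Listₚ.map-++ -_ Π T) ⟨
      φ ++ neg (Π ++ T)        ≈⟨ ++-congˡ φ (map-≃ (- 1#) (λ x → sym (-1*x≈-x x)) (≃-sym (split D))) ⟩
      φ ++ neg ψ               ≈⟨ ≅⇒≃ φ-ψ≅H ⟩
      concat (replicate m ℍ)   ∎)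
    where
    open ≃-Reasoning
    open RingProperties ring using (-1*x≈-x)
    Π = ⊥-sum (gpForms D)
    T = ⊥-sum (map termForm (remainder D))

mainTheorem1 : ∀ {c ℓ} (F : Field c ℓ) → let open QuadraticForms F in
    CharNot2 → (n k : ℕ) → PfisterCard n k →
    (φ : Form) → Nondeg φ → InIPow n φ → SlnAtMost n φ k
mainTheorem1 F _ n k (ps , _ , covers) φ _ (ts , valid , φ∼T) =
  Decomposition⇒SlnAtMost φ φ∼T
    (Decomposition-resp (≃-trans T≃gs (classify-≃ ps covers gs))
                        (classes-Decomposition ps (map (classify ps covers) gs)))
  where
  open QuadraticForms F
  open DiagonalForms F
  open PfisterSums F
  open Grouping F
  gs = proj₁ (terms-SumOfGP ts valid)
  T≃gs = proj₂ (terms-SumOfGP ts valid)
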